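{- Let $\mathcal{A}$ be a $T$-shaped tree automaton. Every vertex of the polytope $P(\mathfrak{L}_{\mathcal{A}})$ is a $0/1$-vector.
   Context: An addressed tree $T$ is a rooted tree with node set $N(T)$, root $r$, children of each node numbered $1,\dots,s$; $\mathrm{par}(u)$ denotes the parent of $u\ne r$. $\Sigma$ is a finite alphabet. A $T$-shaped tree automaton $\mathcal{A}=(\Sigma,Q,F,\Delta)$ has states $Q$ partitioned into cells $\{Q_u\}_{u\in N(T)}$, final states $F\subseteq Q_r$, and transitions $\Delta$ partitioned into $\{\Delta_u\}$ with $\Delta_u\subseteq Q_{u_1}\times\dots\times Q_{u_s}\times\Sigma\times Q_u$ ($u_1,\dots,u_s$ the children of $u$ in order). For $\delta=(q_1,\dots,q_s,a,q)$ let $\mathrm{cnq}(\delta)=q$, $\mathrm{ant}(\delta)=\{q_1,\dots,q_s\}$, $\mathrm{symb}(\delta)=a$. Variables $\mathrm{var}(\mathcal{A})$: $x_{u,a}$ ($u\in N(T),a\in\Sigma$), $y_{u,q}$ ($q\in Q_u$), $z_{u,\delta}$ ($\delta\in\Delta_u$). The system $\mathfrak{L}_{\mathcal{A}}$: (i) all variables in $[0,1]$; (ii) $\sum_{q\in F}y_{r,q}=1$; (iii) $y_{r,q}=0$ for $q\in Q_r\setminus F$; (iv) for all $u$, $q\in Q_u$: $\sum_{\delta\in\Delta_u,\mathrm{cnq}(\delta)=q}z_{u,\delta}=y_{u,q}$; (v) for all $u\ne r$, $q\in Q_u$: $\sum_{\delta\in\Delta_{\mathrm{par}(u)},q\in\mathrm{ant}(\delta)}z_{\mathrm{par}(u),\delta}=y_{u,q}$;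 (vi) for all $u$, $a\in\Sigma$: $\sum_{\delta\in\Delta_u,\mathrm{symb}(\delta)=a}z_{u,\delta}=x_{u,a}$. $P(\mathfrak{L}_{\mathcal{A}})$ is the polytope of all real vectors over $\mathrm{var}(\mathcal{A})$ satisfying these constraints. A vertex of a polytope $P$ is a point of $P$ that is not a convex combination of two distinct points of $P$.
   Formalization: The polytope $P(\mathfrak{L}_{\mathcal{A}})$ is taken over ℚ: its points have rational coordinates rather than being real vectors, and the convex combinations in the vertex condition have rational coefficients. -}

module Defs where

open import Data.Nat using (ℕ; zero; suc)
open import Data.Fin using (Fin; zero; suc; _≟_)
open import Data.Bool using (Bool; true; false; if_then_else_)
open import Data.Product using (Σ; _×_; _,_; proj₁; proj₂)
open import Data.Sum using (_⊎_)
open import Data.Rational using (ℚ; 0ℚ; 1ℚ; _+_; _*_; _-_; _≤_; _<_)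
open import Relation.Binary.PropositionalEquality using (_≡_)
open import Relation.Nullary using (¬_; Dec; yes; no)

-- Addressed trees: finite rooted trees whose children are numbered 1..s
-- (here 0..s-1 via Fin s).

data Tree : Set where
  node : (s : ℕ) → (Fin s → Tree) → Tree

-- Nodes N(T) of a tree, given by their address (path from the root).
data Pos : Tree → Set where
  here  : ∀ {t} → Pos t
  there : ∀ {s f} (i : Fin s) → Pos (f i) → Pos (node s f)

root : ∀ {T} → Pos T
root = here

arity : ∀ {T} → Pos T → ℕ
arity {node s f} here = s
arity (there i p) = arity p

child : ∀ {T} (u : Pos T) → Fin (arity u) → Pos T
child {node s f} here j = there j here
child (there i p) j = there i (child p j)

sumFin : (n : ℕ) → (Fin n → ℚ) → ℚ
sumFin zero    f = 0ℚ
sumFin (suc n) f = f zero + sumFin n (λ i → f (suc i))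

sumWhere : (n : ℕ) {P : Fin n → Set} → ((i : Fin n) → Dec (P i)) → (Fin n → ℚ) → ℚ
sumWhere n P? f = sumFin n (λ i → g i (P? i))
  where
  g : (i : Fin n) → Dec _ → ℚ
  g i (yes _) = f i
  g i (no _)  = 0ℚ

-- The state cell Q_u is Fin (Q u) (cells are disjoint by construction),
-- and Δ_u is given by an injective enumeration δ u : Fin (m u) → Trans u.

module _ {T : Tree} (Q : Pos T → ℕ) (k : ℕ) where
  Trans : Pos T → Set
  Trans u = ((j : Fin (arity u)) → Fin (Q (child u j))) × Fin k × Fin (Q u)

record TreeAutomaton (T : Tree) (k : ℕ) : Set where
  field
    Q     : Pos T → ℕ
    F     : Fin (Q root) → Bool
    m     : Pos T → ℕ
    δ     : (u : Pos T) → Fin (m u) → Trans Q k u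
    δ-inj : ∀ u (i i' : Fin (m u)) →
            (∀ j → proj₁ (δ u i) j ≡ proj₁ (δ u i') j) →
            proj₁ (proj₂ (δ u i)) ≡ proj₁ (proj₂ (δ u i')) →
            proj₂ (proj₂ (δ u i)) ≡ proj₂ (proj₂ (δ u i')) →
            i ≡ i'

  antj : (u : Pos T) → Fin (m u) → (j : Fin (arity u)) → Fin (Q (child u j))
  antj u i = proj₁ (δ u i)

  symb : (u : Pos T) → Fin (m u) → Fin k
  symb u i = proj₁ (proj₂ (δ u i))

  cnq : (u : Pos T) → Fin (m u) → Fin (Q u)
  cnq u i = proj₂ (proj₂ (δ u i))

open TreeAutomaton public

-- Real (here: rational) vectors over var(A)

module _ {T : Tree} {k : ℕ} (A : TreeAutomaton T k) where

  record Point : Set where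
    constructor point
    field
      x : (u : Pos T) → Fin k → ℚ
      y : (u : Pos T) → Fin (Q A u) → ℚ
      z : (u : Pos T) → Fin (m A u) → ℚ

  open Point public

  _≈P_ : Point → Point → Set
  p ≈P p' = (∀ u a → x p u a ≡ x p' u a)
          × (∀ u q → y p u q ≡ y p' u q)
          × (∀ u d → z p u d ≡ z p' u d)

  combo : ℚ → Point → Point → Point
  combo l p p' = point (λ u a → l * x p u a + (1ℚ - l) * x p' u a)
                       (λ u q → l * y p u q + (1ℚ - l) * y p' u q)
                       (λ u d → l * z p u d + (1ℚ - l) * z p' u d)

  InUnit : ℚ → Set
  InUnit v = 0ℚ ≤ v × v ≤ 1ℚ

  record InP (p : Point) : Set where
    field
      bounds-x : ∀ u a → InUnit (x p u a)
      bounds-y : ∀ u q → InUnit (y p u q)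
      bounds-z : ∀ u d → InUnit (z p u d)
      final-sum : sumWhere (Q A root) (λ q → F A q Data.Bool.≟ true) (y p root) ≡ 1ℚ
      nonfinal  : ∀ q → F A q ≡ false → y p root q ≡ 0ℚ
      cnq-eq  : ∀ u q → sumWhere (m A u) (λ d → cnq A u d ≟ q) (z p u) ≡ y p u q
      -- (v)  every u ≠ r is child u' j of u' = par(u); since the cells are
      --      disjoint, q ∈ ant(δ) for q ∈ Q_{child u' j} iff q_j = q.
      ant-eq  : ∀ u' j q → sumWhere (m A u') (λ d → antj A u' d j ≟ q) (z p u')
                             ≡ y p (child u' j) q
      symb-eq : ∀ u a → sumWhere (m A u) (λ d → symb A u d ≟ a) (z p u) ≡ x p u a

  IsVertex : Point → Set
  IsVertex p = InP p ×
    ¬ (Σ Point λ p₁ → Σ Point λ p₂ → Σ ℚ λ l →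
         InP p₁ × InP p₂ × ¬ (p₁ ≈P p₂) × 0ℚ < l × l < 1ℚ × p ≈P combo l p₁ p₂)

  ZeroOne : ℚ → Set
  ZeroOne v = v ≡ 0ℚ ⊎ v ≡ 1ℚ

  Is01 : Point → Set
  Is01 p = (∀ u a → ZeroOne (x p u a))
         × (∀ u q → ZeroOne (y p u q))
         × (∀ u d → ZeroOne (z p u d))

-- A point p of P(𝔏_A) supports an accepting run: constraints (ii), (iv) and (v) give every
-- node z-mass 1, and a transition of positive z-mass at u continues at each child u_j by a
-- transition of positive z-mass whose consequent is its j-th antecedent. The indicator
-- vector r of such a run lies in P(𝔏_A), and so do p ± e (r - p) for e > 0 the least z-mass
-- along the run: every coordinate of p that the run selects is at least e, every other one
-- at most 1 - e. Since p is the midpoint of these two points, at a vertex they coincide,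
-- whence p = r.

{-# OPTIONS --safe #-}
module Submission where

open import Defs
open import Data.Nat using (ℕ)

open import Level using (0ℓ)
open import Algebra.Bundles using (CommutativeRing)
import Algebra.Properties.Group
open import Data.Bool using (true; false)
import Data.Bool as Bool
import Data.Bool.Properties as BoolP
open import Data.Empty using (⊥-elim)
open import Data.Fin using (Fin; zero; suc; punchIn; _≟_)
open import Data.Fin.Properties using (any?; punchInᵢ≢i)
open import Data.List using (_∷_; [])
open import Data.Maybe using (Maybe; just; nothing)
open import Data.Nat using (zero; suc)
open import Data.Product using (Σ; ∃; _×_; _,_; proj₁; proj₂; map₁; map₂)
open import Data.Rational
  using (ℚ; 0ℚ; 1ℚ; ½; _+_; _*_; _-_; -_; _≤_; _<_; _⊓_; 1/_; NonZero; >-nonZero; nonNegative)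
import Data.Rational.Properties as ℚP
open import Data.Sum using (_⊎_; inj₁; inj₂; [_,_]′)
import Data.Sum as Sum
open import Data.Vec.Functional using (removeAt)
open import Function using (_∘_)
open import Relation.Binary.PropositionalEquality
open import Relation.Nullary using (¬_; Dec; yes; no)
open import Relation.Nullary.Decidable using (¬?; decidable-stable; toWitness)
open import Tactic.RingSolver using (solve-∀; solve)
import Tactic.RingSolver.Core.AlmostCommutativeRing as ACR

open import Algebra.Properties.Semiring.Sum (CommutativeRing.semiring ℚP.+-*-commutativeRing)
  using (sum; sum-cong-≗; ∑-distrib-+; ∑-comm; *-distribˡ-sum; sum-remove; sum-replicate-zero)
open Algebra.Properties.Group ℚP.+-0-group using (x∙y⁻¹≈ε⇒x≈y)

ℚ-ring : ACR.AlmostCommutativeRing 0ℓ 0ℓ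
ℚ-ring = ACR.fromCommutativeRing ℚP.+-*-commutativeRing 0≟
  where
  0≟ : ∀ x → Maybe (0ℚ ≡ x)
  0≟ x with 0ℚ ℚP.≟ x
  ... | yes 0≡x = just 0≡x
  ... | no _    = nothing

_∈[0,1] : ℚ → Set
v ∈[0,1] = 0ℚ ≤ v × v ≤ 1ℚ

0≤+ : ∀ {p q} → 0ℚ ≤ p → 0ℚ ≤ q → 0ℚ ≤ p + q
0≤+ = ℚP.+-mono-≤

0≤* : ∀ {p q} → 0ℚ ≤ p → 0ℚ ≤ q → 0ℚ ≤ p * q
0≤* {p} {q} 0≤p 0≤q =
  ℚP.nonNegative⁻¹ (p * q) {{ℚP.nonNeg*nonNeg⇒nonNeg p {{nonNegative 0≤p}} q {{nonNegative 0≤q}}}}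

p≤q⇒0≤q-p : ∀ {p q} → p ≤ q → 0ℚ ≤ q - p
p≤q⇒0≤q-p {p} {q} p≤q = subst (_≤ q - p) (ℚP.+-inverseʳ p) (ℚP.+-monoˡ-≤ (- p) p≤q)

0≤q-p⇒p≤q : ∀ {p q} → 0ℚ ≤ q - p → p ≤ q
0≤q-p⇒p≤q {p} {q} 0≤q-p = subst₂ _≤_ (ℚP.+-identityˡ p) (q-p+p≡q q p) (ℚP.+-monoˡ-≤ p 0≤q-p)
  where
  q-p+p≡q : ∀ q p → q - p + p ≡ q
  q-p+p≡q = solve-∀ ℚ-ring

⊓-pos : ∀ {p q} → 0ℚ < p → 0ℚ < q → 0ℚ < p ⊓ q
⊓-pos {p} {q} 0<p 0<q =
  [ (λ eq → subst (0ℚ <_) (sym eq) 0<p) , (λ eq → subst (0ℚ <_) (sym eq) 0<q) ]′ (ℚP.⊓-sel p q)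

*-cancel-pos : ∀ {c a} → 0ℚ < c → c * a ≡ 0ℚ → a ≡ 0ℚ
*-cancel-pos {c} {a} 0<c ca≡0 = begin
  a                ≡⟨ ℚP.*-identityˡ a ⟨
  1ℚ * a           ≡⟨ cong (_* a) (ℚP.*-inverseˡ c) ⟨
  (1/ c * c) * a   ≡⟨ ℚP.*-assoc (1/ c) c a ⟩
  1/ c * (c * a)   ≡⟨ cong (1/ c *_) ca≡0 ⟩
  1/ c * 0ℚ        ≡⟨ ℚP.*-zeroʳ (1/ c) ⟩
  0ℚ               ∎
  where
  open ≡-Reasoning
  instance
    c≢0 : NonZero c
    c≢0 = >-nonZero 0<c

module _ {e v : ℚ} where

  private
    0≤-by : ∀ {x} d → x ≡ d → 0ℚ ≤ d → 0ℚ ≤ x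
    0≤-by d x≡d 0≤d = subst (0ℚ ≤_) (sym x≡d) 0≤d

    ≤1-by : ∀ {x} d → 1ℚ - x ≡ d → 0ℚ ≤ d → x ≤ 1ℚ
    ≤1-by d 1-x≡d 0≤d = 0≤q-p⇒p≤q (subst (0ℚ ≤_) (sym 1-x≡d) 0≤d)

  -- The two expressions below are v + e (w - v) and v - e (w - v).
  perturb-∈[0,1] : ∀ {w} → 0ℚ ≤ e → v ∈[0,1] →
                   (w ≡ 0ℚ × v + e ≤ 1ℚ) ⊎ (w ≡ 1ℚ × e ≤ v) →
                   (e * w + (1ℚ - e) * v) ∈[0,1] × ((- e) * w + (1ℚ - - e) * v) ∈[0,1]
  perturb-∈[0,1] 0≤e (0≤v , v≤1) (inj₁ (refl , v+e≤1)) =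
    ( 0≤-by ((1ℚ - (v + e)) * v + v * v) (solve (e ∷ v ∷ []) ℚ-ring)
            (0≤+ (0≤* 0≤1-v-e 0≤v) (0≤* 0≤v 0≤v))
    , ≤1-by ((1ℚ - v) + e * v) (solve (e ∷ v ∷ []) ℚ-ring)
            (0≤+ 0≤1-v (0≤* 0≤e 0≤v)) )
    , ( 0≤-by (v + e * v) (solve (e ∷ v ∷ []) ℚ-ring)
              (0≤+ 0≤v (0≤* 0≤e 0≤v))
      , ≤1-by ((1ℚ - (v + e)) + e * (1ℚ - v)) (solve (e ∷ v ∷ []) ℚ-ring)
              (0≤+ 0≤1-v-e (0≤* 0≤e 0≤1-v)) )
    where
    0≤1-v : 0ℚ ≤ 1ℚ - v
    0≤1-v = p≤q⇒0≤q-p v≤1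
    0≤1-v-e : 0ℚ ≤ 1ℚ - (v + e)
    0≤1-v-e = p≤q⇒0≤q-p v+e≤1
  perturb-∈[0,1] 0≤e (0≤v , v≤1) (inj₂ (refl , e≤v)) =
    ( 0≤-by (v + e * (1ℚ - v)) (solve (e ∷ v ∷ []) ℚ-ring)
            (0≤+ 0≤v (0≤* 0≤e 0≤1-v))
    , ≤1-by ((1ℚ - v) * (1ℚ - v) + (1ℚ - v) * (v - e)) (solve (e ∷ v ∷ []) ℚ-ring)
            (0≤+ (0≤* 0≤1-v 0≤1-v) (0≤* 0≤1-v 0≤v-e)) )
    , ( 0≤-by ((v - e) + e * v) (solve (e ∷ v ∷ []) ℚ-ring)
              (0≤+ 0≤v-e (0≤* 0≤e 0≤v))
      , ≤1-by ((1ℚ - v) + e * (1ℚ - v)) (solve (e ∷ v ∷ []) ℚ-ring)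
              (0≤+ 0≤1-v (0≤* 0≤e 0≤1-v)) )
    where
    0≤1-v : 0ℚ ≤ 1ℚ - v
    0≤1-v = p≤q⇒0≤q-p v≤1
    0≤v-e : 0ℚ ≤ v - e
    0≤v-e = p≤q⇒0≤q-p e≤v

perturb-injective : ∀ {e v w} → 0ℚ < e →
                    e * w + (1ℚ - e) * v ≡ (- e) * w + (1ℚ - - e) * v → w ≡ v
perturb-injective {e} {v} {w} 0<e eq =
  x∙y⁻¹≈ε⇒x≈y w v (*-cancel-pos (ℚP.+-mono-< 0<e 0<e) (begin
    (e + e) * (w - v)  ≡⟨ difference e v w ⟩
    p₊ - p₋            ≡⟨ cong (_- p₋) eq ⟩
    p₋ - p₋            ≡⟨ ℚP.+-inverseʳ p₋ ⟩
    0ℚ                 ∎))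
  where
  open ≡-Reasoning
  p₊ p₋ : ℚ
  p₊ = e * w + (1ℚ - e) * v
  p₋ = (- e) * w + (1ℚ - - e) * v
  difference : ∀ e v w → (e + e) * (w - v) ≡ (e * w + (1ℚ - e) * v) - ((- e) * w + (1ℚ - - e) * v)
  difference = solve-∀ ℚ-ring

perturb-midpoint : ∀ e w v →
                   v ≡ ½ * (e * w + (1ℚ - e) * v) + (1ℚ - ½) * ((- e) * w + (1ℚ - - e) * v)
perturb-midpoint = solve-∀ ℚ-ring

select : ∀ {P : Set} → Dec P → ℚ → ℚ
select (yes _) v = v
select (no _)  _ = 0ℚ

𝟙 : ∀ {P : Set} → Dec P → ℚ
𝟙 d = select d 1ℚ

module _ {P : Set} where

  select-pos : ∀ (d : Dec P) {v} → 0ℚ < select d v → P × 0ℚ < v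
  select-pos (yes p) 0<v = p , 0<v
  select-pos (no _)  0<0 = ⊥-elim (ℚP.<-irrefl refl 0<0)

  select-yes : ∀ (d : Dec P) {v} → P → select d v ≡ v
  select-yes (yes _) _  = refl
  select-yes (no ¬p) p  = ⊥-elim (¬p p)

  select-no : ∀ (d : Dec P) {v} → ¬ P → select d v ≡ 0ℚ
  select-no (yes p) ¬p = ⊥-elim (¬p p)
  select-no (no _)  _  = refl

  select-nonneg : ∀ (d : Dec P) {v} → 0ℚ ≤ v → 0ℚ ≤ select d v
  select-nonneg (yes _) 0≤v = 0≤v
  select-nonneg (no _)  _   = ℚP.≤-refl

  select-linear : ∀ (d : Dec P) a b x y → select d (a * x + b * y) ≡ a * select d x + b * select d y
  select-linear (yes _) a b x y = refl
  select-linear (no _)  a b x y = solve (a ∷ b ∷ []) ℚ-ring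

  select-comm : ∀ {R : Set} (d : Dec P) (d′ : Dec R) v → select d (select d′ v) ≡ select d′ (select d v)
  select-comm (yes _) _       _ = refl
  select-comm (no _)  (yes _) _ = refl
  select-comm (no _)  (no _)  _ = refl

  select-complement : ∀ (d : Dec P) v → select d v + select (¬? d) v ≡ v
  select-complement (yes _) v = ℚP.+-identityʳ v
  select-complement (no _)  v = ℚP.+-identityˡ v

  𝟙-cases : ∀ (d : Dec P) → (𝟙 d ≡ 0ℚ × ¬ P) ⊎ (𝟙 d ≡ 1ℚ × P)
  𝟙-cases (no ¬p) = inj₁ (refl , ¬p)
  𝟙-cases (yes p) = inj₂ (refl , p)

  𝟙-∈[0,1] : ∀ (d : Dec P) → 𝟙 d ∈[0,1]
  𝟙-∈[0,1] (yes _) = ℚP.nonNegative⁻¹ 1ℚ , ℚP.≤-refl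
  𝟙-∈[0,1] (no _)  = ℚP.≤-refl , ℚP.nonNegative⁻¹ 1ℚ

sum-linear : ∀ {n} a b (f g : Fin n → ℚ) → sum (λ i → a * f i + b * g i) ≡ a * sum f + b * sum g
sum-linear a b f g = trans (∑-distrib-+ (λ i → a * f i) (λ i → b * g i))
                           (sym (cong₂ _+_ (*-distribˡ-sum a f) (*-distribˡ-sum b g)))

sum-zero : ∀ {n} {f : Fin n → ℚ} → (∀ i → f i ≡ 0ℚ) → sum f ≡ 0ℚ
sum-zero {n} f≗0 = trans (sum-cong-≗ f≗0) (sum-replicate-zero n)

sum-single : ∀ {n} {f : Fin n → ℚ} j → (∀ i → i ≢ j → f i ≡ 0ℚ) → sum f ≡ f j
sum-single {suc n} {f} j f≗0 = begin
  sum f                     ≡⟨ sum-remove {i = j} f ⟩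
  f j + sum (removeAt f j)  ≡⟨ cong (f j +_) (sum-zero (λ i → f≗0 _ (punchInᵢ≢i j i))) ⟩
  f j + 0ℚ                  ≡⟨ ℚP.+-identityʳ (f j) ⟩
  f j                       ∎
  where open ≡-Reasoning

sum-select-≟ : ∀ {n} j (g : Fin n → ℚ) → sum (λ i → select (j ≟ i) (g i)) ≡ g j
sum-select-≟ j g =
  trans (sum-single j (λ i i≢j → select-no (j ≟ i) (i≢j ∘ sym))) (select-yes (j ≟ j) refl)

sum-mono-≤ : ∀ {n} {f g : Fin n → ℚ} → (∀ i → f i ≤ g i) → sum f ≤ sum g
sum-mono-≤ {zero}  f≤g = ℚP.≤-refl
sum-mono-≤ {suc n} f≤g = ℚP.+-mono-≤ (f≤g zero) (sum-mono-≤ (f≤g ∘ suc))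

sum-nonneg : ∀ {n} {f : Fin n → ℚ} → (∀ i → 0ℚ ≤ f i) → 0ℚ ≤ sum f
sum-nonneg {n} {f} 0≤f = subst (_≤ sum f) (sum-replicate-zero n) (sum-mono-≤ 0≤f)

term≤sum : ∀ {n} {f : Fin n → ℚ} → (∀ i → 0ℚ ≤ f i) → ∀ j → f j ≤ sum f
term≤sum {suc n} {f} 0≤f j = begin
  f j                       ≡⟨ ℚP.+-identityʳ (f j) ⟨
  f j + 0ℚ                  ≤⟨ ℚP.+-monoʳ-≤ (f j) (sum-nonneg (0≤f ∘ punchIn j)) ⟩
  f j + sum (removeAt f j)  ≡⟨ sum-remove {i = j} f ⟨
  sum f                     ∎
  where open ℚP.≤-Reasoning

sum-pos : ∀ {n} {f : Fin n → ℚ} → 0ℚ < sum f → ∃ λ i → 0ℚ < f i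
sum-pos {n} {f} 0<sum with any? (λ i → 0ℚ ℚP.<? f i)
... | yes found = found
... | no  none  = ⊥-elim (ℚP.<-irrefl refl (ℚP.<-≤-trans 0<sum sum≤0))
  where
  sum≤0 : sum f ≤ 0ℚ
  sum≤0 = subst (sum f ≤_) (sum-replicate-zero n) (sum-mono-≤ (λ i → ℚP.≮⇒≥ (none ∘ (i ,_))))

sumFin≡sum : ∀ n (f : Fin n → ℚ) → sumFin n f ≡ sum f
sumFin≡sum zero    f = refl
sumFin≡sum (suc n) f = cong (f zero +_) (sumFin≡sum n (f ∘ suc))

-- The summand of sumWhere is a local function of its definition; naming the whole
-- summation makes it reachable for a case split on P? i.
private
  summation : ∀ {n} {P : Fin n → Set} (P? : ∀ i → Dec (P i)) (f : Fin n → ℚ) →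
              Σ (Fin n → ℚ) λ g → sumWhere n P? f ≡ sumFin n g
  summation P? f = _ , refl

  summand≡select : ∀ {n} {P : Fin n → Set} (P? : ∀ i → Dec (P i)) f i →
                   proj₁ (summation P? f) i ≡ select (P? i) (f i)
  summand≡select P? f i with P? i
  ... | yes _ = refl
  ... | no _  = refl

sumWhere≡sum : ∀ {n} {P : Fin n → Set} (P? : ∀ i → Dec (P i)) f →
               sumWhere n P? f ≡ sum (λ i → select (P? i) (f i))
sumWhere≡sum {n} P? f = trans (sumFin≡sum n (proj₁ (summation P? f))) (sum-cong-≗ (summand≡select P? f))

module _ {n : ℕ} {P : Fin n → Set} (P? : ∀ i → Dec (P i)) where

  sumWhere-linear : ∀ a b (f g : Fin n → ℚ) →
                    sumWhere n P? (λ i → a * f i + b * g i) ≡ a * sumWhere n P? f + b * sumWhere n P? g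
  sumWhere-linear a b f g = begin
    sumWhere n P? (λ i → a * f i + b * g i)        ≡⟨ sumWhere≡sum P? _ ⟩
    sum (λ i → select (P? i) (a * f i + b * g i))  ≡⟨ sum-cong-≗ (λ i → select-linear (P? i) a b (f i) (g i)) ⟩
    sum (λ i → a * f′ i + b * g′ i)                ≡⟨ sum-linear a b f′ g′ ⟩
    a * sum f′ + b * sum g′                        ≡⟨ cong₂ (λ s t → a * s + b * t) (sumWhere≡sum P? f)
                                                                                    (sumWhere≡sum P? g) ⟨
    a * sumWhere n P? f + b * sumWhere n P? g      ∎
    where
    open ≡-Reasoning
    f′ g′ : Fin n → ℚ
    f′ i = select (P? i) (f i)
    g′ i = select (P? i) (g i)

  sumWhere-full : ∀ {f} → (∀ i → ¬ P i → f i ≡ 0ℚ) → sumWhere n P? f ≡ sum f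
  sumWhere-full {f} vanish = trans (sumWhere≡sum P? f) (sum-cong-≗ select≗f)
    where
    select≗f : ∀ i → select (P? i) (f i) ≡ f i
    select≗f i with P? i
    ... | yes _  = refl
    ... | no ¬p = sym (vanish i ¬p)

  sumWhere-complement : ∀ f → sumWhere n P? f + sumWhere n (¬? ∘ P?) f ≡ sum f
  sumWhere-complement f = begin
    sumWhere n P? f + sumWhere n (¬? ∘ P?) f
      ≡⟨ cong₂ _+_ (sumWhere≡sum P? f) (sumWhere≡sum (¬? ∘ P?) f) ⟩
    sum (λ i → select (P? i) (f i)) + sum (λ i → select (¬? (P? i)) (f i))
      ≡⟨ ∑-distrib-+ (λ i → select (P? i) (f i)) (λ i → select (¬? (P? i)) (f i)) ⟨
    sum (λ i → select (P? i) (f i) + select (¬? (P? i)) (f i))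
      ≡⟨ sum-cong-≗ (λ i → select-complement (P? i) (f i)) ⟩
    sum f ∎
    where open ≡-Reasoning

  term≤sumWhere : ∀ {f} → (∀ i → 0ℚ ≤ f i) → ∀ {j} → P j → f j ≤ sumWhere n P? f
  term≤sumWhere {f} 0≤f {j} pj =
    subst₂ _≤_ (select-yes (P? j) pj) (sym (sumWhere≡sum P? f))
           (term≤sum (λ i → select-nonneg (P? i) (0≤f i)) j)

  sumWhere-pos : ∀ {f} → 0ℚ < sumWhere n P? f → ∃ λ i → P i × 0ℚ < f i
  sumWhere-pos {f} 0<Σ = map₂ (select-pos (P? _)) (sum-pos (subst (0ℚ <_) (sumWhere≡sum P? f) 0<Σ))

  sumWhere-indicator : ∀ {R : Fin n → Set} (R? : ∀ i → Dec (R i)) j → R j → (∀ i → R i → i ≡ j) →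
                       sumWhere n P? (λ i → 𝟙 (R? i)) ≡ 𝟙 (P? j)
  sumWhere-indicator R? j Rj R⇒≡j = begin
    sumWhere n P? (λ i → 𝟙 (R? i))        ≡⟨ sumWhere≡sum P? _ ⟩
    sum (λ i → select (P? i) (𝟙 (R? i)))  ≡⟨ sum-single j vanishes ⟩
    select (P? j) (𝟙 (R? j))              ≡⟨ cong (select (P? j)) (select-yes (R? j) Rj) ⟩
    𝟙 (P? j)                              ∎
    where
    open ≡-Reasoning
    vanishes : ∀ i → i ≢ j → select (P? i) (𝟙 (R? i)) ≡ 0ℚ
    vanishes i i≢j = trans (select-comm (P? i) (R? i) 1ℚ) (select-no (R? i) (i≢j ∘ R⇒≡j i))

sumWhere+term≤sum : ∀ {n} {P : Fin n → Set} (P? : ∀ i → Dec (P i)) {f} → (∀ i → 0ℚ ≤ f i) →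
                    ∀ {j} → ¬ P j → sumWhere n P? f + f j ≤ sum f
sumWhere+term≤sum {n} P? {f} 0≤f {j} ¬pj = begin
  sumWhere n P? f + f j                     ≤⟨ ℚP.+-monoʳ-≤ (sumWhere n P? f)
                                                                 (term≤sumWhere (¬? ∘ P?) 0≤f ¬pj) ⟩
  sumWhere n P? f + sumWhere n (¬? ∘ P?) f  ≡⟨ sumWhere-complement P? f ⟩
  sum f                                     ∎
  where open ℚP.≤-Reasoning

sum-fibres : ∀ {n k} (c : Fin n → Fin k) (f : Fin n → ℚ) →
             sum (λ q → sumWhere n (λ i → c i ≟ q) f) ≡ sum f
sum-fibres {n} c f = begin
  sum (λ q → sumWhere n (λ i → c i ≟ q) f)        ≡⟨ sum-cong-≗ (λ q → sumWhere≡sum (λ i → c i ≟ q) f) ⟩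
  sum (λ q → sum (λ i → select (c i ≟ q) (f i)))  ≡⟨ ∑-comm (λ q i → select (c i ≟ q) (f i)) ⟩
  sum (λ i → sum (λ q → select (c i ≟ q) (f i)))  ≡⟨ sum-cong-≗ (λ i → sum-select-≟ (c i) (λ _ → f i)) ⟩
  sum f                                           ∎
  where open ≡-Reasoning

topDown : ∀ {T} (C : Pos T → Set) → C root → (∀ u → C u → ∀ j → C (child u j)) → ∀ u → C u
topDown C c-root extend here        = c-root
topDown C c-root extend (there i u) = topDown (C ∘ there i) (extend here c-root i) (extend ∘ there i) u

topDown-child : ∀ {T} (C : Pos T → Set) c-root extend (u : Pos T) j →
                topDown C c-root extend (child u j) ≡ extend u (topDown C c-root extend u) j
topDown-child {node _ _} C c-root extend here        j = refl
topDown-child            C c-root extend (there i u) j =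
  topDown-child (C ∘ there i) (extend here c-root i) (extend ∘ there i) u j

PositiveLowerBound : ∀ {I : Set} → (I → ℚ) → Set
PositiveLowerBound h = Σ ℚ λ e → 0ℚ < e × ∀ i → e ≤ h i

Fin-lowerBound : ∀ n (h : Fin n → ℚ) → (∀ i → 0ℚ < h i) → PositiveLowerBound h
Fin-lowerBound zero    h 0<h = 1ℚ , ℚP.positive⁻¹ 1ℚ , λ ()
Fin-lowerBound (suc n) h 0<h =
  let e , 0<e , e≤h = Fin-lowerBound n (h ∘ suc) (0<h ∘ suc) in
  h zero ⊓ e , ⊓-pos (0<h zero) 0<e , λ where
    zero    → ℚP.p⊓q≤p (h zero) e
    (suc i) → ℚP.≤-trans (ℚP.p⊓q≤q (h zero) e) (e≤h i)

Pos-lowerBound : ∀ {T} (h : Pos T → ℚ) → (∀ u → 0ℚ < h u) → PositiveLowerBound h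
Pos-lowerBound {node s f} h 0<h =
  let e , 0<e , e≤ = Fin-lowerBound s (proj₁ ∘ subtree) (proj₁ ∘ proj₂ ∘ subtree) in
  h here ⊓ e , ⊓-pos (0<h here) 0<e , λ where
    here        → ℚP.p⊓q≤p (h here) e
    (there i u) → ℚP.≤-trans (ℚP.p⊓q≤q (h here) e) (ℚP.≤-trans (e≤ i) (proj₂ (proj₂ (subtree i)) u))
  where
  subtree : ∀ i → PositiveLowerBound (h ∘ there i)
  subtree i = Pos-lowerBound (h ∘ there i) (0<h ∘ there i)

module _ {T : Tree} {k : ℕ} (A : TreeAutomaton T k) where

  data Coordinate : Set where
    x-coord : (u : Pos T) → Fin k → Coordinate
    y-coord : (u : Pos T) → Fin (Q A u) → Coordinate
    z-coord : (u : Pos T) → Fin (m A u) → Coordinate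

  record Run : Set where
    field
      transition : (u : Pos T) → Fin (m A u)
      consistent : ∀ u j → cnq A (child u j) (transition (child u j)) ≡ antj A u (transition u) j
      accepting  : F A (cnq A root (transition root)) ≡ true

module _ {T : Tree} {k : ℕ} {A : TreeAutomaton T k} where

  _⟦_⟧ : Point A → Coordinate A → ℚ
  p ⟦ x-coord u a ⟧ = x p u a
  p ⟦ y-coord u q ⟧ = y p u q
  p ⟦ z-coord u d ⟧ = z p u d

  nodeOf : Coordinate A → Pos T
  nodeOf (x-coord u _) = u
  nodeOf (y-coord u _) = u
  nodeOf (z-coord u _) = u

  -- On P(𝔏_A) every coordinate is the z-mass of the transitions at one node that it selects.
  Selects : ∀ (c : Coordinate A) → Fin (m A (nodeOf c)) → Set
  Selects (x-coord u a) d = symb A u d ≡ a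
  Selects (y-coord u q) d = cnq A u d ≡ q
  Selects (z-coord u d′) d = d′ ≡ d

  selects? : ∀ (c : Coordinate A) d → Dec (Selects c d)
  selects? (x-coord u a) d = symb A u d ≟ a
  selects? (y-coord u q) d = cnq A u d ≟ q
  selects? (z-coord u d′) d = d′ ≟ d

  combo-⟦⟧ : ∀ l p p′ (c : Coordinate A) → combo A l p p′ ⟦ c ⟧ ≡ l * p ⟦ c ⟧ + (1ℚ - l) * p′ ⟦ c ⟧
  combo-⟦⟧ l p p′ (x-coord u a) = refl
  combo-⟦⟧ l p p′ (y-coord u q) = refl
  combo-⟦⟧ l p p′ (z-coord u d) = refl

  ≈P⇒⟦⟧≡ : ∀ {p p′} → _≈P_ A p p′ → ∀ c → p ⟦ c ⟧ ≡ p′ ⟦ c ⟧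
  ≈P⇒⟦⟧≡ (x≡ , y≡ , z≡) (x-coord u a) = x≡ u a
  ≈P⇒⟦⟧≡ (x≡ , y≡ , z≡) (y-coord u q) = y≡ u q
  ≈P⇒⟦⟧≡ (x≡ , y≡ , z≡) (z-coord u d) = z≡ u d

  Is01-by-coordinates : ∀ {p} → (∀ c → ZeroOne A (p ⟦ c ⟧)) → Is01 A p
  Is01-by-coordinates ⟦⟧01 =
    (λ u a → ⟦⟧01 (x-coord u a)) , (λ u q → ⟦⟧01 (y-coord u q)) , (λ u d → ⟦⟧01 (z-coord u d))

  module _ {p : Point A} (p∈P : InP A p) where
    open InP p∈P

    coordinate-as-z-mass : ∀ c → p ⟦ c ⟧ ≡ sumWhere (m A (nodeOf c)) (selects? c) (z p (nodeOf c))
    coordinate-as-z-mass (x-coord u a) = sym (symb-eq u a)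
    coordinate-as-z-mass (y-coord u q) = sym (cnq-eq u q)
    coordinate-as-z-mass (z-coord u d) =
      sym (trans (sumWhere≡sum (λ d′ → d ≟ d′) (z p u)) (sum-select-≟ d (z p u)))

    coordinate-∈[0,1] : ∀ c → p ⟦ c ⟧ ∈[0,1]
    coordinate-∈[0,1] (x-coord u a) = bounds-x u a
    coordinate-∈[0,1] (y-coord u q) = bounds-y u q
    coordinate-∈[0,1] (z-coord u d) = bounds-z u d

  combo-InP : ∀ l {p p′} → InP A p → InP A p′ →
              (∀ c → combo A l p p′ ⟦ c ⟧ ∈[0,1]) → InP A (combo A l p p′)
  combo-InP l p∈P p′∈P combo∈[0,1] = record
    { bounds-x  = λ u a → combo∈[0,1] (x-coord u a)
    ; bounds-y  = λ u q → combo∈[0,1] (y-coord u q)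
    ; bounds-z  = λ u d → combo∈[0,1] (z-coord u d)
    ; final-sum = trans (preserved (λ q → F A q Bool.≟ true) (final-sum p∈P) (final-sum p′∈P))
                        (affine-const 1ℚ)
    ; nonfinal  = λ q q∉F → trans (cong₂ (λ s t → l * s + (1ℚ - l) * t)
                                         (nonfinal p∈P q q∉F) (nonfinal p′∈P q q∉F))
                                  (affine-const 0ℚ)
    ; cnq-eq    = λ u q → preserved (λ d → cnq A u d ≟ q) (cnq-eq p∈P u q) (cnq-eq p′∈P u q)
    ; ant-eq    = λ u j q → preserved (λ d → antj A u d j ≟ q) (ant-eq p∈P u j q) (ant-eq p′∈P u j q)
    ; symb-eq   = λ u a → preserved (λ d → symb A u d ≟ a) (symb-eq p∈P u a) (symb-eq p′∈P u a)
    }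
    where
    open InP
    affine-const : ∀ a → l * a + (1ℚ - l) * a ≡ a
    affine-const a = solve (l ∷ a ∷ []) ℚ-ring

    preserved : ∀ {n} {P : Fin n → Set} (P? : ∀ i → Dec (P i)) {f f′ : Fin n → ℚ} {s s′} →
                sumWhere n P? f ≡ s → sumWhere n P? f′ ≡ s′ →
                sumWhere n P? (λ i → l * f i + (1ℚ - l) * f′ i) ≡ l * s + (1ℚ - l) * s′
    preserved P? {f} {f′} f≡s f′≡s′ =
      trans (sumWhere-linear P? l (1ℚ - l) f f′) (cong₂ (λ s s′ → l * s + (1ℚ - l) * s′) f≡s f′≡s′)

  module _ (ρ : Run A) where
    open Run ρ

    runPoint : Point A
    runPoint = point (λ u a → 𝟙 (symb A u (transition u) ≟ a))
                     (λ u q → 𝟙 (cnq A u (transition u) ≟ q))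
                     (λ u d → 𝟙 (d ≟ transition u))

    runPoint-⟦⟧ : ∀ c → runPoint ⟦ c ⟧ ≡ 𝟙 (selects? c (transition (nodeOf c)))
    runPoint-⟦⟧ (x-coord u a) = refl
    runPoint-⟦⟧ (y-coord u q) = refl
    runPoint-⟦⟧ (z-coord u d) = refl

    runPoint-01 : ∀ c → ZeroOne A (runPoint ⟦ c ⟧)
    runPoint-01 c = subst (ZeroOne A) (sym (runPoint-⟦⟧ c))
                          (Sum.map proj₁ proj₁ (𝟙-cases (selects? c (transition (nodeOf c)))))

    runPoint-InP : InP A runPoint
    runPoint-InP = record
      { bounds-x  = λ u a → 𝟙-∈[0,1] (symb A u (transition u) ≟ a)
      ; bounds-y  = λ u q → 𝟙-∈[0,1] (cnq A u (transition u) ≟ q)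
      ; bounds-z  = λ u d → 𝟙-∈[0,1] (d ≟ transition u)
      ; final-sum = trans (sumWhere-indicator (λ q → F A q Bool.≟ true) (q-root ≟_) q-root
                                              refl (λ _ → sym))
                          (select-yes (F A q-root Bool.≟ true) accepting)
      ; nonfinal  = λ q q∉F → select-no (q-root ≟ q)
                                        (λ { refl → true≢false (trans (sym accepting) q∉F) })
      ; cnq-eq    = λ u q → at-transition u (λ d → cnq A u d ≟ q)
      ; ant-eq    = λ u j q → trans (at-transition u (λ d → antj A u d j ≟ q))
                                    (cong (λ q′ → 𝟙 (q′ ≟ q)) (sym (consistent u j)))
      ; symb-eq   = λ u a → at-transition u (λ d → symb A u d ≟ a)
      }
      where
      q-root : Fin (Q A root)
      q-root = cnq A root (transition root)

      at-transition : ∀ u {P : Fin (m A u) → Set} (P? : ∀ d → Dec (P d)) →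
                      sumWhere (m A u) P? (λ d → 𝟙 (d ≟ transition u)) ≡ 𝟙 (P? (transition u))
      at-transition u P? = sumWhere-indicator P? (_≟ transition u) (transition u) refl (λ _ d≡ → d≡)

      true≢false : ¬ true ≡ false
      true≢false ()

  vertex-midpoint⇒≡ : ∀ {p p₁ p₂} → IsVertex A p → InP A p₁ → InP A p₂ → _≈P_ A p (combo A ½ p₁ p₂) →
                      ∀ c → p₁ ⟦ c ⟧ ≡ p₂ ⟦ c ⟧
  vertex-midpoint⇒≡ {p₁ = p₁} {p₂} (_ , no-split) p₁∈P p₂∈P p≈mid c =
    decidable-stable (p₁ ⟦ c ⟧ ℚP.≟ p₂ ⟦ c ⟧) λ p₁≢p₂ →
      no-split (p₁ , p₂ , ½ , p₁∈P , p₂∈P , (λ p₁≈p₂ → p₁≢p₂ (≈P⇒⟦⟧≡ p₁≈p₂ c)) , 0<½ , ½<1 , p≈mid)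
    where
    0<½ : 0ℚ < ½
    0<½ = ℚP.positive⁻¹ ½
    ½<1 : ½ < 1ℚ
    ½<1 = toWitness {a? = ½ ℚP.<? 1ℚ} _

  perturbation-midpoint : ∀ e r p → _≈P_ A p (combo A ½ (combo A e r p) (combo A (- e) r p))
  perturbation-midpoint e r p = (λ u a → perturb-midpoint e (x r u a) (x p u a))
                              , (λ u q → perturb-midpoint e (y r u q) (y p u q))
                              , (λ u d → perturb-midpoint e (z r u d) (z p u d))

module _ {T : Tree} {k : ℕ} {A : TreeAutomaton T k} {p : Point A} (p∈P : InP A p) where
  open InP p∈P
  open Run

  z-nonneg : ∀ u d → 0ℚ ≤ z p u d
  z-nonneg u d = proj₁ (bounds-z u d)

  sum-y≡sum-z : ∀ u → sum (y p u) ≡ sum (z p u)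
  sum-y≡sum-z u = trans (sum-cong-≗ (sym ∘ cnq-eq u)) (sum-fibres (cnq A u) (z p u))

  sum-y-child≡sum-z : ∀ u j → sum (y p (child u j)) ≡ sum (z p u)
  sum-y-child≡sum-z u j = trans (sum-cong-≗ (sym ∘ ant-eq u j)) (sum-fibres (λ d → antj A u d j) (z p u))

  z-mass : ∀ u → sum (z p u) ≡ 1ℚ
  z-mass = topDown (λ u → sum (z p u) ≡ 1ℚ) root-mass λ u mass j →
    trans (sym (sum-y≡sum-z (child u j))) (trans (sum-y-child≡sum-z u j) mass)
    where
    open ≡-Reasoning
    nonfinal′ : ∀ q → ¬ F A q ≡ true → y p root q ≡ 0ℚ
    nonfinal′ q q∉F = nonfinal q (BoolP.¬-not q∉F)

    root-mass : sum (z p root) ≡ 1ℚ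
    root-mass = begin
      sum (z p root)                                         ≡⟨ sum-y≡sum-z root ⟨
      sum (y p root)                                         ≡⟨ sumWhere-full (λ q → F A q Bool.≟ true) nonfinal′ ⟨
      sumWhere (Q A root) (λ q → F A q Bool.≟ true) (y p root) ≡⟨ final-sum ⟩
      1ℚ                                                     ∎

  supported-transition : ∀ u q → 0ℚ < y p u q → ∃ λ d → cnq A u d ≡ q × 0ℚ < z p u d
  supported-transition u q 0<y =
    sumWhere-pos (λ d → cnq A u d ≟ q) (subst (0ℚ <_) (sym (cnq-eq u q)) 0<y)

  Supported : Pos T → Set
  Supported u = Σ (Fin (m A u)) λ d → 0ℚ < z p u d

  supported-successor : ∀ u (s : Supported u) j →
                        ∃ λ d′ → cnq A (child u j) d′ ≡ antj A u (proj₁ s) j × 0ℚ < z p (child u j) d′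
  supported-successor u (d , 0<z) j =
    supported-transition (child u j) (antj A u d j) (ℚP.<-≤-trans 0<z z≤y)
    where
    z≤y : z p u d ≤ y p (child u j) (antj A u d j)
    z≤y = subst (z p u d ≤_) (ant-eq u j (antj A u d j))
                (term≤sumWhere (λ d′ → antj A u d′ j ≟ antj A u d j) (z-nonneg u) refl)

  supportedRun : Σ (Run A) λ ρ → ∀ u → 0ℚ < z p u (transition ρ u)
  supportedRun = ρ , proj₂ ∘ choice
    where
    final-state : ∃ λ q → F A q ≡ true × 0ℚ < y p root q
    final-state = sumWhere-pos (λ q → F A q Bool.≟ true)
                               (subst (0ℚ <_) (sym final-sum) (ℚP.positive⁻¹ 1ℚ))

    initial : ∃ λ d → cnq A root d ≡ proj₁ final-state × 0ℚ < z p root d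
    initial = supported-transition root (proj₁ final-state) (proj₂ (proj₂ final-state))

    extend : ∀ u → Supported u → ∀ j → Supported (child u j)
    extend u s j = map₂ proj₂ (supported-successor u s j)

    choice : ∀ u → Supported u
    choice = topDown Supported (map₂ proj₂ initial) extend

    ρ : Run A
    ρ = record
      { transition = proj₁ ∘ choice
      ; consistent = λ u j →
          trans (cong (cnq A (child u j) ∘ proj₁) (topDown-child Supported _ extend u j))
                (proj₁ (proj₂ (supported-successor u (choice u) j)))
      ; accepting  = subst (λ q → F A q ≡ true) (sym (proj₁ (proj₂ initial))) (proj₁ (proj₂ final-state))
      }

  module _ (ρ : Run A) {e : ℚ} (0<e : 0ℚ < e) (e≤ : ∀ u → e ≤ z p u (transition ρ u)) where

    run-gap : ∀ c → (runPoint ρ ⟦ c ⟧ ≡ 0ℚ × p ⟦ c ⟧ + e ≤ 1ℚ) ⊎ (runPoint ρ ⟦ c ⟧ ≡ 1ℚ × e ≤ p ⟦ c ⟧)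
    run-gap c = Sum.map (map₁ (trans (runPoint-⟦⟧ ρ c)) ∘ map₂ excluded)
                        (map₁ (trans (runPoint-⟦⟧ ρ c)) ∘ map₂ included)
                        (𝟙-cases (selects? c d))
      where
      u : Pos T
      u = nodeOf c
      d : Fin (m A u)
      d = transition ρ u
      p⟦c⟧≡ : p ⟦ c ⟧ ≡ sumWhere (m A u) (selects? c) (z p u)
      p⟦c⟧≡ = coordinate-as-z-mass p∈P c
      open ℚP.≤-Reasoning

      excluded : ¬ Selects c d → p ⟦ c ⟧ + e ≤ 1ℚ
      excluded ¬sel = begin
        p ⟦ c ⟧ + e                                      ≤⟨ ℚP.+-monoʳ-≤ (p ⟦ c ⟧) (e≤ u) ⟩
        p ⟦ c ⟧ + z p u d                                ≡⟨ cong (_+ z p u d) p⟦c⟧≡ ⟩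
        sumWhere (m A u) (selects? c) (z p u) + z p u d  ≤⟨ sumWhere+term≤sum (selects? c) (z-nonneg u) ¬sel ⟩
        sum (z p u)                                      ≡⟨ z-mass u ⟩
        1ℚ                                               ∎

      included : Selects c d → e ≤ p ⟦ c ⟧
      included sel = begin
        e                                        ≤⟨ e≤ u ⟩
        z p u d                                  ≤⟨ term≤sumWhere (selects? c) (z-nonneg u) sel ⟩
        sumWhere (m A u) (selects? c) (z p u)    ≡⟨ p⟦c⟧≡ ⟨
        p ⟦ c ⟧                                  ∎

    perturbations-InP : InP A (combo A e (runPoint ρ) p) × InP A (combo A (- e) (runPoint ρ) p)
    perturbations-InP = combo-InP e (runPoint-InP ρ) p∈P (λ c → in-unit e c (proj₁ (bounds c)))
                      , combo-InP (- e) (runPoint-InP ρ) p∈P (λ c → in-unit (- e) c (proj₂ (bounds c)))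
      where
      r : Point A
      r = runPoint ρ
      bounds : ∀ c → (e * r ⟦ c ⟧ + (1ℚ - e) * p ⟦ c ⟧) ∈[0,1]
                   × ((- e) * r ⟦ c ⟧ + (1ℚ - - e) * p ⟦ c ⟧) ∈[0,1]
      bounds c = perturb-∈[0,1] (ℚP.<⇒≤ 0<e) (coordinate-∈[0,1] p∈P c) (run-gap c)
      in-unit : ∀ l c → (l * r ⟦ c ⟧ + (1ℚ - l) * p ⟦ c ⟧) ∈[0,1] → combo A l r p ⟦ c ⟧ ∈[0,1]
      in-unit l c = subst _∈[0,1] (sym (combo-⟦⟧ l r p c))

    vertex≡runPoint : IsVertex A p → ∀ c → p ⟦ c ⟧ ≡ runPoint ρ ⟦ c ⟧
    vertex≡runPoint vertex c = sym (perturb-injective 0<e (begin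
      e * r ⟦ c ⟧ + (1ℚ - e) * p ⟦ c ⟧          ≡⟨ combo-⟦⟧ e r p c ⟨
      combo A e r p ⟦ c ⟧                       ≡⟨ vertex-midpoint⇒≡ vertex (proj₁ perturbations-InP)
                                                     (proj₂ perturbations-InP) (perturbation-midpoint e r p) c ⟩
      combo A (- e) r p ⟦ c ⟧                   ≡⟨ combo-⟦⟧ (- e) r p c ⟩
      (- e) * r ⟦ c ⟧ + (1ℚ - - e) * p ⟦ c ⟧    ∎))
      where
      open ≡-Reasoning
      r : Point A
      r = runPoint ρ

lemma4p15 : ∀ {T : Tree} {k : ℕ} (A : TreeAutomaton T k) (p : Point A) →
            IsVertex A p → Is01 A p
lemma4p15 A p vertex@(p∈P , _) =
  let ρ , supported = supportedRun p∈P
      e , 0<e , e≤  = Pos-lowerBound (λ u → z p u (Run.transition ρ u)) supported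
  in Is01-by-coordinates λ c →
       subst (ZeroOne A) (sym (vertex≡runPoint p∈P ρ 0<e e≤ vertex c)) (runPoint-01 ρ c)
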